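{- There is an absolute constant $c>1$ such that for all sufficiently large $d$, the number of irreducible tight partitions of the $d$-dimensional cube $Q_d$ into subcubes is at least $c^{n}$, where $n=2^{d-1}$.
   Context: $Q_d=\{0,1\}^d$. A subcube of $Q_d$ is a set of vertices obtained by fixing the values of some of the coordinates and letting the remaining coordinates range freely. A subcube partition of $Q_d$ is a partition of $\{0,1\}^d$ into subcubes. It is tight if every coordinate $i\in\{1,\ldots,d\}$ is fixed in at least one of the subcubes of the partition. It is irreducible if there is no subfamily of the parts, consisting of at least two but not all of the parts, whose union is a subcube. -}

module Defs where

open import Data.Nat using (ℕ; zero; suc; _∸_; _^_; _*_; _≤_; _<_)
open import Data.Bool using (Bool)
open import Data.Maybe using (Maybe; just; nothing)
open import Data.Fin using (Fin)
open import Data.Vec using (Vec; lookup)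
open import Data.Vec.Relation.Binary.Pointwise.Inductive using (Pointwise)
open import Data.List using (List)
open import Data.List.Membership.Propositional using (_∈_; _∉_)
open import Data.Product using (Σ; ∃; ∃-syntax; _×_; _,_)
open import Relation.Binary.PropositionalEquality using (_≡_; _≢_)
open import Relation.Nullary using (¬_)
open import Function.Bundles using (_⇔_)

Point : ℕ → Set
Point d = Vec Bool d

-- A subcube of Q_d is given by its pattern: for each coordinate either a
-- fixed value (just b) or free (nothing).  Distinct patterns describe
-- distinct (nonempty) subcubes, so patterns are in bijection with subcubes.
Subcube : ℕ → Set
Subcube d = Vec (Maybe Bool) d

data Matches : Bool → Maybe Bool → Set where
  free  : ∀ {b} → Matches b nothing
  fixed : ∀ {b} → Matches b (just b)

_∈ᶜ_ : ∀ {d} → Point d → Subcube d → Set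
x ∈ᶜ C = Pointwise Matches x C

-- A family of subcubes, read as the SET of subcubes occurring in the list.
Family : ℕ → Set
Family d = List (Subcube d)

IsSubcubePartition : ∀ {d} → Family d → Set
IsSubcubePartition {d} F =
  (∀ (x : Point d) → ∃[ C ] (C ∈ F × x ∈ᶜ C)) ×
  (∀ (C C′ : Subcube d) → C ∈ F → C′ ∈ F → C ≢ C′ →
     ∀ (x : Point d) → ¬ (x ∈ᶜ C × x ∈ᶜ C′))

IsTight : ∀ {d} → Family d → Set
IsTight {d} F = ∀ (i : Fin d) → ∃[ C ] (C ∈ F × lookup C i ≢ nothing)

IsIrreducible : ∀ {d} → Family d → Set
IsIrreducible {d} F =
  ¬ (Σ (Family d) λ G →
       (∀ C → C ∈ G → C ∈ F) ×
       (∃[ C ] ∃[ C′ ] (C ∈ G × C′ ∈ G × C ≢ C′)) ×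
       (∃[ C ] (C ∈ F × C ∉ G)) ×
       (∃[ P ] (∀ (x : Point d) → x ∈ᶜ P ⇔ (∃[ C ] (C ∈ G × x ∈ᶜ C)))))

IsIrreducibleTightPartition : ∀ {d} → Family d → Set
IsIrreducibleTightPartition F =
  IsSubcubePartition F × IsTight F × IsIrreducible F

SameParts : ∀ {d} → Family d → Family d → Set
SameParts {d} F G = ∀ (C : Subcube d) → C ∈ F ⇔ C ∈ G

-- "The number of irreducible tight partitions of Q_d is at least N":
-- there are N pairwise different ones.
AtLeastIrredTight : ℕ → ℕ → Set
AtLeastIrredTight d N =
  Σ (Fin N → Family d) λ F →
    (∀ i → IsIrreducibleTightPartition (F i)) ×
    (∀ i j → SameParts (F i) (F j) → i ≡ j)

-- Write d = 4 + m, so that Q_d = Q_4 × Q_m.  The partition consists of the slab {0000} × Q_m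
-- together with, over every vertex u of Q_m, the parts h × {u} for h in a partition
-- Π (parity u) (σ u) of Q_4 ∖ {0000}.  There are two such partitions for each parity, so the
-- 2^(2^m) choice functions σ give pairwise different partitions.
-- Irreducibility follows once every subcube P ≠ Q_d lies inside a part or is crossed by one
-- (meets it without lying inside it).  For P = S × T this reduces to the same property of
-- {0000} ∪ Π p b on Q_4, checked exhaustively, and to the fact that partitions of opposite
-- parity share no part: a subcube T with two vertices contains two of opposite parity, and S
-- cannot lie inside a part over both.  Finally 2^(d-1) = 8 · 2^m and 13^8 ≤ 2 · 12^8, so
-- 2^(2^m) ≥ (13/12)^(2^(d-1)).

module Submission where

open import Defs
open import Data.Nat using (ℕ; zero; suc; _+_; _*_; _^_; _∸_; _≤_; _<_; z≤n; s≤s)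
open import Data.Nat.Properties
  using (≤ᵇ⇒≤; ^-*-assoc; ^-monoˡ-≤; ^-distribˡ-+-*; *-commutativeSemigroup; n<1+n; module ≤-Reasoning)
open import Data.Bool using (Bool; true; false; not; _xor_)
import Data.Bool.Properties as Bool
open import Data.Maybe using (Maybe; just; nothing)
import Data.Maybe.Properties as Maybe
open import Data.Fin using (Fin; combine; remQuot) renaming (zero to fz; suc to fs)
import Data.Fin as Fin
open import Data.Fin.Properties using (combine-remQuot; join-splitAt)
open import Data.Vec using (Vec; []; _∷_; _++_; map; replicate; lookup; splitAt)
import Data.Vec.Properties as Vec
open import Data.Vec.Relation.Binary.Pointwise.Inductive using ([]; _∷_; decidable; ++⁺; ++ˡ⁻; ++ʳ⁻)
open import Data.List using (List; []; _∷_; [_]; cartesianProductWith; concatMap) renaming (map to mapL)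
open import Data.List.Relation.Unary.Any using (here; there; any?)
import Data.List.Relation.Unary.All as All
open import Data.List.Membership.Propositional using (_∈_; _∉_; find; lose)
open import Data.List.Membership.Propositional.Properties
  using (∈-cartesianProductWith⁺; ∈-map⁺; ∈-map⁻; ∈-concatMap⁺; ∈-concatMap⁻)
import Data.List.Membership.DecPropositional as DecMembership
open import Data.Product using (∃; ∃-syntax; _×_; _,_; proj₁; proj₂)
open import Data.Sum using (_⊎_; inj₁; inj₂)
open import Data.Empty using (⊥-elim)
open import Function using (_∘_; id)
open import Function.Bundles using (Equivalence)
open import Relation.Binary.PropositionalEquality
  using (_≡_; _≢_; refl; sym; trans; cong; cong₂; subst; module ≡-Reasoning)
open import Relation.Nullary using (¬_; Dec; yes; no)
open import Relation.Nullary.Decidable using (map′; toWitness; ¬?; _×-dec_; _⊎-dec_; _→-dec_)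
open import Algebra.Properties.CommutativeSemigroup *-commutativeSemigroup using (interchange)

matches? : ∀ b c → Dec (Matches b c)
matches? b nothing  = yes free
matches? b (just c) = map′ (λ { refl → fixed }) (λ { fixed → refl }) (b Bool.≟ c)

_∈ᶜ?_ : ∀ {d} (x : Point d) (C : Subcube d) → Dec (x ∈ᶜ C)
_∈ᶜ?_ = decidable matches?

_≟ᶜ_ : ∀ {d} (C D : Subcube d) → Dec (C ≡ D)
_≟ᶜ_ = Vec.≡-dec (Maybe.≡-dec Bool._≟_)

∀∈? : ∀ {A : Set} {Q : A → Set} → (∀ a → Dec (Q a)) → (xs : List A) → Dec (∀ a → a ∈ xs → Q a)
∀∈? Q? xs = map′ (λ all a → All.lookup all) (λ f → All.tabulate (f _)) (All.all? Q? xs)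

∃∈? : ∀ {A : Set} {Q : A → Set} → (∀ a → Dec (Q a)) → (xs : List A) → Dec (∃[ a ] (a ∈ xs × Q a))
∃∈? Q? xs = map′ find (λ (_ , a∈ , q) → lose a∈ q) (any? Q? xs)

module Exhaustive {A : Set} (xs : List A) (complete : ∀ a → a ∈ xs) where

  ∀? : ∀ {Q : A → Set} → (∀ a → Dec (Q a)) → Dec (∀ a → Q a)
  ∀? Q? = map′ (λ f a → f a (complete a)) (λ f a _ → f a) (∀∈? Q? xs)

  ∃? : ∀ {Q : A → Set} → (∀ a → Dec (Q a)) → Dec (∃ Q)
  ∃? Q? = map′ (λ (a , _ , q) → a , q) (λ (a , q) → a , complete a , q) (∃∈? Q? xs)

vectors : ∀ {A : Set} → List A → (n : ℕ) → List (Vec A n)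
vectors xs zero    = [ [] ]
vectors xs (suc n) = cartesianProductWith _∷_ xs (vectors xs n)

∈-vectors : ∀ {A : Set} {xs : List A} → (∀ a → a ∈ xs) → ∀ {n} (v : Vec A n) → v ∈ vectors xs n
∈-vectors complete []      = here refl
∈-vectors complete (a ∷ v) = ∈-cartesianProductWith⁺ _∷_ (complete a) (∈-vectors complete v)

booleans : List Bool
booleans = false ∷ true ∷ []

∈-booleans : ∀ b → b ∈ booleans
∈-booleans false = here refl
∈-booleans true  = there (here refl)

patterns : List (Maybe Bool)
patterns = nothing ∷ just false ∷ just true ∷ []

∈-patterns : ∀ c → c ∈ patterns
∈-patterns nothing      = here refl
∈-patterns (just false) = there (here refl)
∈-patterns (just true)  = there (there (here refl))

module Booleans = Exhaustive booleans ∈-booleans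
module Points {d : ℕ} = Exhaustive (vectors booleans d) (∈-vectors ∈-booleans)
module Subcubes {d : ℕ} = Exhaustive (vectors patterns d) (∈-vectors ∈-patterns)

full : (d : ℕ) → Subcube d
full d = replicate d nothing

∈-full : ∀ {d} (x : Point d) → x ∈ᶜ full d
∈-full []      = []
∈-full (_ ∷ x) = free ∷ ∈-full x

vertex : ∀ {d} → Point d → Subcube d
vertex = map just

∈-vertex : ∀ {d} (u : Point d) → u ∈ᶜ vertex u
∈-vertex []      = []
∈-vertex (_ ∷ u) = fixed ∷ ∈-vertex u

∈-vertex⁻ : ∀ {d} {x u : Point d} → x ∈ᶜ vertex u → x ≡ u
∈-vertex⁻ {x = []}    {[]}    []          = refl
∈-vertex⁻ {x = _ ∷ _} {_ ∷ _} (fixed ∷ p) = cong (_ ∷_) (∈-vertex⁻ p)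

vertex-fixed : ∀ {d} (u : Point d) (i : Fin d) → lookup (vertex u) i ≢ nothing
vertex-fixed u i eq with trans (sym (Vec.lookup-map i just u)) eq
... | ()

origin : (d : ℕ) → Point d
origin d = replicate d false

corner : ∀ {d} → Subcube d → Point d
corner []            = []
corner (nothing ∷ C) = false ∷ corner C
corner (just b ∷ C)  = b ∷ corner C

corner-∈ : ∀ {d} (C : Subcube d) → corner C ∈ᶜ C
corner-∈ []            = []
corner-∈ (nothing ∷ C) = free ∷ corner-∈ C
corner-∈ (just b ∷ C)  = fixed ∷ corner-∈ C

¬matches-not : ∀ b → ¬ Matches (not b) (just b)
¬matches-not false ()
¬matches-not true  ()

Whole : ∀ {d} → Subcube d → Set
Whole {d} C = ∀ (x : Point d) → x ∈ᶜ C

whole-or-missing : ∀ {d} (C : Subcube d) → Whole C ⊎ ∃[ y ] (¬ y ∈ᶜ C)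
whole-or-missing []            = inj₁ λ { [] → [] }
whole-or-missing (nothing ∷ C) with whole-or-missing C
... | inj₁ whole     = inj₁ λ { (_ ∷ x) → free ∷ whole x }
... | inj₂ (y , y∉C) = inj₂ (false ∷ y , λ { (_ ∷ y∈C) → y∉C y∈C })
whole-or-missing (just b ∷ C)  = inj₂ (not b ∷ corner C , λ { (m ∷ _) → ¬matches-not b m })

parity : ∀ {d} → Point d → Bool
parity []      = false
parity (b ∷ u) = b xor parity u

vertex-or-bichromatic : ∀ {d} (C : Subcube d) →
  (∃[ a ] (C ≡ vertex a)) ⊎ (∃[ u ] ∃[ u′ ] (u ∈ᶜ C × u′ ∈ᶜ C × parity u′ ≡ not (parity u)))
vertex-or-bichromatic []            = inj₁ ([] , refl)
vertex-or-bichromatic (nothing ∷ C) =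
  inj₂ (false ∷ corner C , true ∷ corner C , free ∷ corner-∈ C , free ∷ corner-∈ C , refl)
vertex-or-bichromatic (just b ∷ C) with vertex-or-bichromatic C
... | inj₁ (a , refl)                 = inj₁ (b ∷ a , refl)
... | inj₂ (u , u′ , u∈ , u′∈ , flip) = inj₂ (b ∷ u , b ∷ u′ , fixed ∷ u∈ , fixed ∷ u′∈ , xor-not b flip)
  where
  xor-not : ∀ b {p q} → q ≡ not p → b xor q ≡ not (b xor p)
  xor-not false refl = refl
  xor-not true  refl = refl

Separated : ∀ {d} → Subcube d → Subcube d → Set
Separated C D = (∃[ x ] (x ∈ᶜ C × ¬ x ∈ᶜ D)) ⊎ (∃[ x ] (x ∈ᶜ D × ¬ x ∈ᶜ C))

separated-∷ : ∀ {d b c} {C D : Subcube d} → Matches b c → Separated C D → Separated (c ∷ C) (c ∷ D)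
separated-∷ {b = b} m (inj₁ (x , x∈C , x∉D)) = inj₁ (b ∷ x , m ∷ x∈C , λ { (_ ∷ x∈D) → x∉D x∈D })
separated-∷ {b = b} m (inj₂ (x , x∈D , x∉C)) = inj₂ (b ∷ x , m ∷ x∈D , λ { (_ ∷ x∈C) → x∉C x∈C })

≢⇒separated : ∀ {d} {C D : Subcube d} → C ≢ D → Separated C D
≢⇒separated {C = []} {[]} C≢D = ⊥-elim (C≢D refl)
≢⇒separated {C = nothing ∷ C} {nothing ∷ D} C≢D =
  separated-∷ {b = false} free (≢⇒separated (C≢D ∘ cong (nothing ∷_)))
≢⇒separated {C = nothing ∷ C} {just b ∷ D} _ =
  inj₁ (not b ∷ corner C , free ∷ corner-∈ C , λ { (m ∷ _) → ¬matches-not b m })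
≢⇒separated {C = just b ∷ C} {nothing ∷ D} _ =
  inj₂ (not b ∷ corner D , free ∷ corner-∈ D , λ { (m ∷ _) → ¬matches-not b m })
≢⇒separated {C = just b ∷ C} {just b′ ∷ D} C≢D with b Bool.≟ b′
... | yes refl = separated-∷ fixed (≢⇒separated (C≢D ∘ cong (just b ∷_)))
... | no b≢b′  = inj₁ (b ∷ corner C , fixed ∷ corner-∈ C , λ { (fixed ∷ _) → b≢b′ refl })

_⊆ᶜ_ : ∀ {d} → Subcube d → Subcube d → Set
P ⊆ᶜ Q = ∀ x → x ∈ᶜ P → x ∈ᶜ Q

_crosses_ : ∀ {d} → Subcube d → Subcube d → Set
D crosses P = (∃[ x ] (x ∈ᶜ D × x ∈ᶜ P)) × (∃[ y ] (y ∈ᶜ D × ¬ y ∈ᶜ P))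

full-crosses : ∀ {d} {T : Subcube d} {y : Point d} → ¬ y ∈ᶜ T → full d crosses T
full-crosses {T = T} {y} y∉T = (corner T , ∈-full _ , corner-∈ T) , (y , ∈-full y , y∉T)

separated-crosses : ∀ {d} {S h h′ : Subcube d} {v : Point d} →
  S ⊆ᶜ h → S ⊆ᶜ h′ → v ∈ᶜ h → ¬ v ∈ᶜ h′ → h crosses S
separated-crosses {S = S} S⊆h S⊆h′ v∈h v∉h′ =
  (corner S , S⊆h _ (corner-∈ S) , corner-∈ S) , (_ , v∈h , v∉h′ ∘ S⊆h′ _)

InsideOrCrossed : ∀ {d} → Family d → Subcube d → Set
InsideOrCrossed F P = Whole P ⊎ (∃[ D ] (D ∈ F × P ⊆ᶜ D)) ⊎ (∃[ D ] (D ∈ F × D crosses P))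

part-unique : ∀ {d} {F : Family d} → IsSubcubePartition F →
  ∀ {C D x} → C ∈ F → D ∈ F → x ∈ᶜ C → x ∈ᶜ D → C ≡ D
part-unique (_ , disjoint) {C} {D} {x} C∈F D∈F x∈C x∈D with C ≟ᶜ D
... | yes C≡D = C≡D
... | no  C≢D = ⊥-elim (disjoint C D C∈F D∈F C≢D x (x∈C , x∈D))

-- If the union P of a subfamily G is a subcube: P whole forces G to contain every part, P inside
-- a part D forces G = {D}, and a part crossing P must belong to G while sticking out of P.
irreducible-if-insideOrCrossed : ∀ {d} {F : Family d} → IsSubcubePartition F →
  (∀ P → InsideOrCrossed F P) → IsIrreducible F
irreducible-if-insideOrCrossed partition insideOrCrossed
  (G , G⊆F , (C₁ , C₂ , C₁∈G , C₂∈G , C₁≢C₂) , (C₀ , C₀∈F , C₀∉G) , (P , P≡⋃G))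
  with insideOrCrossed P
... | inj₁ whole with Equivalence.to (P≡⋃G (corner C₀)) (whole _)
...   | C , C∈G , x∈C with part-unique partition (G⊆F C C∈G) C₀∈F x∈C (corner-∈ C₀)
...     | refl = C₀∉G C∈G
irreducible-if-insideOrCrossed partition insideOrCrossed
  (G , G⊆F , (C₁ , C₂ , C₁∈G , C₂∈G , C₁≢C₂) , _ , (P , P≡⋃G)) | inj₂ (inj₁ (D , D∈F , P⊆D)) =
  C₁≢C₂ (trans (≡D C₁∈G) (sym (≡D C₂∈G)))
  where
  ≡D : ∀ {C} → C ∈ G → C ≡ D
  ≡D {C} C∈G = part-unique partition (G⊆F C C∈G) D∈F (corner-∈ C)
    (P⊆D _ (Equivalence.from (P≡⋃G (corner C)) (C , C∈G , corner-∈ C)))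
irreducible-if-insideOrCrossed partition insideOrCrossed
  (G , G⊆F , _ , _ , (P , P≡⋃G)) | inj₂ (inj₂ (D , D∈F , (x , x∈D , x∈P) , (y , y∈D , y∉P)))
  with Equivalence.to (P≡⋃G x) x∈P
... | C , C∈G , x∈C with part-unique partition (G⊆F C C∈G) D∈F x∈C x∈D
...   | refl = y∉P (Equivalence.from (P≡⋃G y) (C , C∈G , y∈D))

isSubcubePartition? : ∀ {d} (F : Family d) → Dec (IsSubcubePartition F)
isSubcubePartition? F =
  Points.∀? (λ x → ∃∈? (x ∈ᶜ?_) F)
  ×-dec map′ (λ f C C′ C∈ C′∈ → f C C∈ C′ C′∈) (λ f C C∈ C′ C′∈ → f C C′ C∈ C′∈)
    (∀∈? (λ C → ∀∈? (λ C′ → ¬? (C ≟ᶜ C′) →-dec Points.∀? (λ x → ¬? ((x ∈ᶜ? C) ×-dec (x ∈ᶜ? C′)))) F) F)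

insideOrCrossed? : ∀ {d} (F : Family d) (P : Subcube d) → Dec (InsideOrCrossed F P)
insideOrCrossed? F P =
  Points.∀? (_∈ᶜ? P)
  ⊎-dec ∃∈? (λ D → Points.∀? (λ x → (x ∈ᶜ? P) →-dec (x ∈ᶜ? D))) F
  ⊎-dec ∃∈? (λ D → Points.∃? (λ x → (x ∈ᶜ? D) ×-dec (x ∈ᶜ? P))
                   ×-dec Points.∃? (λ y → (y ∈ᶜ? D) ×-dec ¬? (y ∈ᶜ? P))) F

module _ {k m : ℕ} where

  ++-whole : {S : Subcube k} {T : Subcube m} → Whole S → Whole T → Whole (S ++ T)
  ++-whole S-whole T-whole x with splitAt k x
  ... | v , w , refl = ++⁺ (S-whole v) (T-whole w)

  ++-⊆ᶜ : {S S′ : Subcube k} {T T′ : Subcube m} → S ⊆ᶜ S′ → T ⊆ᶜ T′ → (S ++ T) ⊆ᶜ (S′ ++ T′)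
  ++-⊆ᶜ {S} S⊆S′ T⊆T′ x x∈ with splitAt k x
  ... | v , w , refl = ++⁺ (S⊆S′ v (++ˡ⁻ v S x∈)) (T⊆T′ w (++ʳ⁻ v S x∈))

  ++-crossesˡ : {D S : Subcube k} {R T : Subcube m} {w : Point m} →
    w ∈ᶜ R → w ∈ᶜ T → D crosses S → (D ++ R) crosses (S ++ T)
  ++-crossesˡ {S = S} w∈R w∈T ((x , x∈D , x∈S) , (y , y∈D , y∉S)) =
    (x ++ _ , ++⁺ x∈D w∈R , ++⁺ x∈S w∈T) , (y ++ _ , ++⁺ y∈D w∈R , y∉S ∘ ++ˡ⁻ y S)

  ++-crossesʳ : {D S : Subcube k} {R T : Subcube m} {v : Point k} →
    v ∈ᶜ D → v ∈ᶜ S → R crosses T → (D ++ R) crosses (S ++ T)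
  ++-crossesʳ {S = S} v∈D v∈S ((x , x∈R , x∈T) , (y , y∈R , y∉T)) =
    (_ ++ x , ++⁺ v∈D x∈R , ++⁺ v∈S x∈T) , (_ ++ y , ++⁺ v∈D y∈R , y∉T ∘ ++ʳ⁻ _ S)

  originSlab : Subcube (k + m)
  originSlab = vertex (origin k) ++ full m

  lift : Point m → Subcube k → Subcube (k + m)
  lift u h = h ++ vertex u

  blowup : (Point m → Family k) → Family (k + m)
  blowup B = originSlab ∷ concatMap (λ u → mapL (lift u) (B u)) (vectors booleans m)

module _ {k m : ℕ} {B : Point m → Family k} where

  lift-∈ : ∀ {u h} → h ∈ B u → lift u h ∈ blowup B
  lift-∈ {u} h∈ = there (∈-concatMap⁺ _ (lose (∈-vectors ∈-booleans u) (∈-map⁺ (lift u) h∈)))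

  ∈-blowup⁻ : ∀ {C} → C ∈ blowup B →
    C ≡ originSlab {k} {m} ⊎ ∃[ u ] ∃[ h ] (h ∈ B u × C ≡ lift u h)
  ∈-blowup⁻ (here refl) = inj₁ refl
  ∈-blowup⁻ (there C∈) with find (∈-concatMap⁻ _ {xs = vectors booleans m} C∈)
  ... | u , _ , C∈lifts with ∈-map⁻ (lift u) C∈lifts
  ...   | h , h∈ , refl = inj₂ (u , h , h∈ , refl)

  lift-∈⁻ : ∀ {u h} → ¬ origin k ∈ᶜ h → lift u h ∈ blowup B → h ∈ B u
  lift-∈⁻ {u} {h} 0∉h lift∈ with ∈-blowup⁻ lift∈
  ... | inj₁ eq rewrite Vec.++-injectiveˡ h (vertex (origin k)) eq = ⊥-elim (0∉h (∈-vertex (origin k)))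
  ... | inj₂ (u′ , h′ , h′∈ , eq) with Vec.++-injective h h′ eq
  ...   | refl , u≡u′ with ∈-vertex⁻ (subst (u ∈ᶜ_) u≡u′ (∈-vertex u))
  ...     | refl = h′∈

  over : ∀ u {h} → h ∈ vertex (origin k) ∷ B u → ∃[ R ] (h ++ R ∈ blowup B × u ∈ᶜ R)
  over u (here refl) = full m , here refl , ∈-full u
  over u (there h∈)  = vertex u , lift-∈ h∈ , ∈-vertex u

record Admissible {k m : ℕ} (B : Point m → Family k) : Set where
  field
    avoids-origin         : ∀ u h → h ∈ B u → ¬ origin k ∈ᶜ h
    fibre-partition       : ∀ u → IsSubcubePartition (vertex (origin k) ∷ B u)
    fibre-insideOrCrossed : ∀ u S → InsideOrCrossed (vertex (origin k) ∷ B u) S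
    nonempty              : ∀ u → ∃[ h ] (h ∈ B u)
    parity-disjoint       : ∀ u u′ → parity u′ ≡ not (parity u) → ∀ h → h ∈ B u → h ∉ B u′

module _ {k m : ℕ} {B : Point m → Family k} (admissible : Admissible B) where
  open Admissible admissible

  blowup-partition : IsSubcubePartition (blowup B)
  blowup-partition = cover , disjoint
    where
    cover : ∀ x → ∃[ C ] (C ∈ blowup B × x ∈ᶜ C)
    cover x with splitAt k x
    ... | v , w , refl with proj₁ (fibre-partition w) v
    ...   | h , h∈ , v∈h with over w h∈
    ...     | R , h++R∈ , w∈R = h ++ R , h++R∈ , ++⁺ v∈h w∈R

    slab-disjoint : ∀ {u h} v w → h ∈ B u → (v ++ w) ∈ᶜ originSlab {k} {m} → ¬ (v ++ w) ∈ᶜ lift u h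
    slab-disjoint {h = h} v w h∈ vw∈slab vw∈lift with ∈-vertex⁻ (++ˡ⁻ v (vertex (origin k)) vw∈slab)
    ... | refl = avoids-origin _ h h∈ (++ˡ⁻ v h vw∈lift)

    disjoint : ∀ C C′ → C ∈ blowup B → C′ ∈ blowup B → C ≢ C′ → ∀ x → ¬ (x ∈ᶜ C × x ∈ᶜ C′)
    disjoint C C′ C∈ C′∈ C≢C′ x (x∈C , x∈C′) with splitAt k x
    ... | v , w , refl with ∈-blowup⁻ {k} {m} C∈ | ∈-blowup⁻ {k} {m} C′∈
    ... | inj₁ refl | inj₁ refl = C≢C′ refl
    ... | inj₁ refl | inj₂ (_ , _ , h′∈ , refl) = slab-disjoint v w h′∈ x∈C x∈C′
    ... | inj₂ (_ , _ , h∈ , refl) | inj₁ refl = slab-disjoint v w h∈ x∈C′ x∈C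
    ... | inj₂ (_ , h , h∈ , refl) | inj₂ (_ , h′ , h′∈ , refl)
      with ∈-vertex⁻ (++ʳ⁻ v h x∈C) | ∈-vertex⁻ (++ʳ⁻ v h′ x∈C′)
    ...   | refl | refl = C≢C′ (cong (_++ vertex w)
            (part-unique (fibre-partition w) (there h∈) (there h′∈) (++ˡ⁻ v h x∈C) (++ˡ⁻ v h′ x∈C′)))

  blowup-tight : IsTight (blowup B)
  blowup-tight i with Fin.splitAt k i | join-splitAt k m i
  ... | inj₁ j | refl =
    originSlab {k} {m} , here refl ,
    vertex-fixed (origin k) j ∘ trans (sym (Vec.lookup-++ˡ (vertex (origin k)) (full m) j))
  ... | inj₂ j | refl with nonempty (origin m)
  ...   | h , h∈ =
    lift (origin m) h , lift-∈ h∈ ,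
    vertex-fixed (origin m) j ∘ trans (sym (Vec.lookup-++ʳ h (vertex (origin m)) j))

  fibre-resolve : ∀ u {S} → ¬ origin k ∈ᶜ S →
    (∃[ h ] (h ∈ B u × S ⊆ᶜ h)) ⊎ (∃[ h ] (h ∈ vertex (origin k) ∷ B u × h crosses S))
  fibre-resolve u {S} 0∉S with fibre-insideOrCrossed u S
  ... | inj₁ S-whole = ⊥-elim (0∉S (S-whole _))
  ... | inj₂ (inj₁ (_ , here refl , S⊆0)) =
    ⊥-elim (0∉S (subst (_∈ᶜ S) (∈-vertex⁻ (S⊆0 _ (corner-∈ S))) (corner-∈ S)))
  ... | inj₂ (inj₁ (h , there h∈ , S⊆h)) = inj₁ (h , h∈ , S⊆h)
  ... | inj₂ (inj₂ crossing) = inj₂ crossing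

  lift-crossing : ∀ {S T u} → u ∈ᶜ T →
    ∃[ h ] (h ∈ vertex (origin k) ∷ B u × h crosses S) → InsideOrCrossed (blowup B) (S ++ T)
  lift-crossing u∈T (h , h∈ , h-crosses-S) with over _ h∈
  ... | R , h++R∈ , u∈R = inj₂ (inj₂ (h ++ R , h++R∈ , ++-crossesˡ u∈R u∈T h-crosses-S))

  insideOrCrossed-origin∈ : ∀ {S T} → origin k ∈ᶜ S → InsideOrCrossed (blowup B) (S ++ T)
  insideOrCrossed-origin∈ {S} {T} 0∈S with whole-or-missing T
  ... | inj₂ (y , y∉T) =
    inj₂ (inj₂ (originSlab {k} {m} , here refl , ++-crossesʳ (∈-vertex (origin k)) 0∈S (full-crosses y∉T)))
  ... | inj₁ T-whole with fibre-insideOrCrossed (origin m) S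
  ...   | inj₁ S-whole = inj₁ (++-whole S-whole T-whole)
  ...   | inj₂ (inj₁ (_ , here refl , S⊆0)) =
    inj₂ (inj₁ (originSlab {k} {m} , here refl , ++-⊆ᶜ S⊆0 (λ w _ → ∈-full w)))
  ...   | inj₂ (inj₁ (h , there h∈ , S⊆h)) = ⊥-elim (avoids-origin _ h h∈ (S⊆h _ 0∈S))
  ...   | inj₂ (inj₂ crossing) = lift-crossing (T-whole (origin m)) crossing

  insideOrCrossed-origin∉ : ∀ {S T} → ¬ origin k ∈ᶜ S → InsideOrCrossed (blowup B) (S ++ T)
  insideOrCrossed-origin∉ {T = T} 0∉S with vertex-or-bichromatic T
  ... | inj₁ (a , refl) with fibre-resolve a 0∉S
  ...   | inj₁ (h , h∈ , S⊆h) = inj₂ (inj₁ (lift a h , lift-∈ h∈ , ++-⊆ᶜ S⊆h (λ _ → id)))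
  ...   | inj₂ crossing = lift-crossing (∈-vertex a) crossing
  insideOrCrossed-origin∉ 0∉S | inj₂ (u , u′ , u∈T , u′∈T , flip)
    with fibre-resolve u 0∉S | fibre-resolve u′ 0∉S
  ... | inj₂ crossing | _ = lift-crossing u∈T crossing
  ... | _ | inj₂ crossing = lift-crossing u′∈T crossing
  ... | inj₁ (h , h∈ , S⊆h) | inj₁ (h′ , h′∈ , S⊆h′)
    with ≢⇒separated {C = h} {h′} (λ { refl → parity-disjoint u u′ flip h h∈ h′∈ })
  ...   | inj₁ (_ , v∈h , v∉h′) = lift-crossing u∈T (h , there h∈ , separated-crosses S⊆h S⊆h′ v∈h v∉h′)
  ...   | inj₂ (_ , v∈h′ , v∉h) = lift-crossing u′∈T (h′ , there h′∈ , separated-crosses S⊆h′ S⊆h v∈h′ v∉h)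

  blowup-insideOrCrossed : ∀ P → InsideOrCrossed (blowup B) P
  blowup-insideOrCrossed P with splitAt k P
  ... | S , T , refl with origin k ∈ᶜ? S
  ...   | yes 0∈S = insideOrCrossed-origin∈ 0∈S
  ...   | no  0∉S = insideOrCrossed-origin∉ 0∉S

  blowup-irreducibleTight : IsIrreducibleTightPartition (blowup B)
  blowup-irreducibleTight = blowup-partition , blowup-tight ,
    irreducible-if-insideOrCrossed blowup-partition blowup-insideOrCrossed

private
  O I ∗ : Maybe Bool
  O = just false
  I = just true
  ∗ = nothing

Π : Bool → Bool → Family 4
Π false false =
  (O ∷ O ∷ ∗ ∷ I ∷ []) ∷ (O ∷ ∗ ∷ I ∷ O ∷ []) ∷ (O ∷ I ∷ O ∷ ∗ ∷ []) ∷ (∗ ∷ I ∷ I ∷ I ∷ []) ∷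
  (I ∷ O ∷ ∗ ∷ ∗ ∷ []) ∷ (I ∷ I ∷ ∗ ∷ O ∷ []) ∷ (I ∷ I ∷ O ∷ I ∷ []) ∷ []
Π false true =
  (O ∷ O ∷ ∗ ∷ I ∷ []) ∷ (O ∷ ∗ ∷ I ∷ O ∷ []) ∷ (O ∷ I ∷ O ∷ ∗ ∷ []) ∷ (∗ ∷ I ∷ I ∷ I ∷ []) ∷
  (I ∷ ∗ ∷ O ∷ ∗ ∷ []) ∷ (I ∷ O ∷ I ∷ ∗ ∷ []) ∷ (I ∷ I ∷ I ∷ O ∷ []) ∷ []
Π true false =
  (O ∷ ∗ ∷ O ∷ I ∷ []) ∷ (O ∷ O ∷ I ∷ ∗ ∷ []) ∷ (∗ ∷ I ∷ ∗ ∷ O ∷ []) ∷ (O ∷ I ∷ I ∷ I ∷ []) ∷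
  (I ∷ O ∷ ∗ ∷ O ∷ []) ∷ (I ∷ ∗ ∷ ∗ ∷ I ∷ []) ∷ []
Π true true =
  (O ∷ ∗ ∷ O ∷ I ∷ []) ∷ (O ∷ ∗ ∷ I ∷ ∗ ∷ []) ∷ (∗ ∷ I ∷ O ∷ O ∷ []) ∷ (I ∷ O ∷ O ∷ ∗ ∷ []) ∷
  (I ∷ ∗ ∷ I ∷ O ∷ []) ∷ (I ∷ O ∷ I ∷ I ∷ []) ∷ (I ∷ I ∷ ∗ ∷ I ∷ []) ∷ []

open DecMembership (_≟ᶜ_ {4}) using () renaming (_∈?_ to _∈Π?_)

Π-nonempty : ∀ p b → ∃[ h ] (h ∈ Π p b)
Π-nonempty false false = _ , here refl
Π-nonempty false true  = _ , here refl
Π-nonempty true  false = _ , here refl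
Π-nonempty true  true  = _ , here refl

Π-avoids-origin : ∀ p b h → h ∈ Π p b → ¬ origin 4 ∈ᶜ h
Π-avoids-origin = toWitness {a? = Booleans.∀? λ p → Booleans.∀? λ b →
  ∀∈? (λ h → ¬? (origin 4 ∈ᶜ? h)) (Π p b)} _

Π-partition : ∀ p b → IsSubcubePartition (vertex (origin 4) ∷ Π p b)
Π-partition = toWitness {a? = Booleans.∀? λ p → Booleans.∀? λ b →
  isSubcubePartition? (vertex (origin 4) ∷ Π p b)} _

Π-insideOrCrossed : ∀ p b S → InsideOrCrossed (vertex (origin 4) ∷ Π p b) S
Π-insideOrCrossed = toWitness {a? = Booleans.∀? λ p → Booleans.∀? λ b →
  Subcubes.∀? (insideOrCrossed? (vertex (origin 4) ∷ Π p b))} _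

Π-parity-disjoint : ∀ p b b′ h → h ∈ Π p b → h ∉ Π (not p) b′
Π-parity-disjoint = toWitness {a? = Booleans.∀? λ p → Booleans.∀? λ b → Booleans.∀? λ b′ →
  ∀∈? (λ h → ¬? (h ∈Π? Π (not p) b′)) (Π p b)} _

Π-injective : ∀ p b b′ → (∀ h → h ∈ Π p b → h ∈ Π p b′) → b ≡ b′
Π-injective = toWitness {a? = Booleans.∀? λ p → Booleans.∀? λ b → Booleans.∀? λ b′ →
  ∀∈? (λ h → h ∈Π? Π p b′) (Π p b) →-dec (b Bool.≟ b′)} _

bit : Bool → Fin 2
bit false = fz
bit true  = fs fz

bool : Fin 2 → Bool
bool fz      = false
bool (fs fz) = true

bit-bool : ∀ i → bit (bool i) ≡ i
bit-bool fz      = refl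
bit-bool (fs fz) = refl

index : ∀ {n} → Point n → Fin (2 ^ n)
index []      = fz
index (b ∷ u) = combine (bit b) (index u)

point : ∀ n → Fin (2 ^ n) → Point n
point zero    _ = []
point (suc n) i = bool (proj₁ (remQuot {2} (2 ^ n) i)) ∷ point n (proj₂ (remQuot {2} (2 ^ n) i))

index-point : ∀ n (i : Fin (2 ^ n)) → index (point n i) ≡ i
index-point zero    fz = refl
index-point (suc n) i  = begin
  combine (bit (bool q)) (index (point n r)) ≡⟨ cong₂ combine (bit-bool q) (index-point n r) ⟩
  combine q r                                ≡⟨ combine-remQuot {2} (2 ^ n) i ⟩
  i                                          ∎
  where
  open ≡-Reasoning
  q = proj₁ (remQuot {2} (2 ^ n) i)
  r = proj₂ (remQuot {2} (2 ^ n) i)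

lookup-extensional : ∀ {A : Set} {n} {s t : Vec A n} → (∀ i → lookup s i ≡ lookup t i) → s ≡ t
lookup-extensional {s = s} {t} s≗t =
  trans (sym (Vec.tabulate∘lookup s)) (trans (Vec.tabulate-cong s≗t) (Vec.tabulate∘lookup t))

atLeastIrredTight-fromPoints : ∀ {n d} (F : Point n → Family d) →
  (∀ s → IsIrreducibleTightPartition (F s)) → (∀ s t → SameParts (F s) (F t) → s ≡ t) →
  AtLeastIrredTight d (2 ^ n)
atLeastIrredTight-fromPoints {n} F good distinct = F ∘ point n , good ∘ point n , λ i j same → begin
  i                 ≡⟨ sym (index-point n i) ⟩
  index (point n i) ≡⟨ cong index (distinct _ _ same) ⟩
  index (point n j) ≡⟨ index-point n j ⟩
  j                 ∎
  where open ≡-Reasoning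

module _ (m : ℕ) where

  layers : Point (2 ^ m) → Point m → Family 4
  layers s u = Π (parity u) (lookup s (index u))

  layers-admissible : ∀ s → Admissible (layers s)
  layers-admissible s = record
    { avoids-origin         = λ u → Π-avoids-origin _ _
    ; fibre-partition       = λ u → Π-partition _ _
    ; fibre-insideOrCrossed = λ u → Π-insideOrCrossed _ _
    ; nonempty              = λ u → Π-nonempty _ _
    ; parity-disjoint       = λ u u′ flip h h∈ →
        subst (λ p → h ∉ Π p (lookup s (index u′))) (sym flip) (Π-parity-disjoint _ _ _ h h∈)
    }

  blowup-layers-injective : ∀ s t → SameParts (blowup (layers s)) (blowup (layers t)) → s ≡ t
  blowup-layers-injective s t same =
    lookup-extensional λ i →
      subst (λ j → lookup s j ≡ lookup t j) (index-point m i) (choices-agree (point m i))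
    where
    choices-agree : ∀ u → lookup s (index u) ≡ lookup t (index u)
    choices-agree u = Π-injective (parity u) _ _ λ h h∈ →
      lift-∈⁻ (Π-avoids-origin _ _ h h∈) (Equivalence.to (same (lift u h)) (lift-∈ h∈))

  irreducibleTightPartitions : AtLeastIrredTight (4 + m) (2 ^ 2 ^ m)
  irreducibleTightPartitions = atLeastIrredTight-fromPoints (blowup ∘ layers)
    (blowup-irreducibleTight ∘ layers-admissible) blowup-layers-injective

^-distribʳ-* : ∀ a b n → (a * b) ^ n ≡ a ^ n * b ^ n
^-distribʳ-* a b zero    = refl
^-distribʳ-* a b (suc n) =
  trans (cong (a * b *_) (^-distribʳ-* a b n)) (interchange a b (a ^ n) (b ^ n))

growth : ∀ m → 13 ^ 2 ^ (3 + m) ≤ 2 ^ 2 ^ m * 12 ^ 2 ^ (3 + m)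
growth m = begin
  13 ^ 2 ^ (3 + m)         ≡⟨ cong (13 ^_) (^-distribˡ-+-* 2 3 m) ⟩
  13 ^ (8 * M)             ≡⟨ ^-*-assoc 13 8 M ⟨
  (13 ^ 8) ^ M             ≤⟨ ^-monoˡ-≤ M (≤ᵇ⇒≤ (13 ^ 8) (2 * 12 ^ 8) _) ⟩
  (2 * 12 ^ 8) ^ M         ≡⟨ ^-distribʳ-* 2 (12 ^ 8) M ⟩
  2 ^ M * (12 ^ 8) ^ M     ≡⟨ cong (2 ^ M *_) (^-*-assoc 12 8 M) ⟩
  2 ^ M * 12 ^ (8 * M)     ≡⟨ cong (λ e → 2 ^ M * 12 ^ e) (^-distribˡ-+-* 2 3 m) ⟨
  2 ^ M * 12 ^ 2 ^ (3 + m) ∎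
  where
  open ≤-Reasoning
  M = 2 ^ m

proposition1p11 : ∃[ p ] ∃[ q ] (0 < q × q < p ×
    ∃[ D ] ∀ (d : ℕ) → D ≤ d →
    ∃[ N ] (p ^ (2 ^ (d ∸ 1)) ≤ N * q ^ (2 ^ (d ∸ 1)) × AtLeastIrredTight d N))
proposition1p11 = 13 , 12 , s≤s z≤n , n<1+n 12 , 4 , λ where
  .(4 + m) (s≤s (s≤s (s≤s (s≤s {n = m} z≤n)))) → 2 ^ 2 ^ m , growth m , irreducibleTightPartitions m
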